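{- Let $k\geq 2$, let $\alpha_1,\ldots,\alpha_{2k}$ be positive integers with $\alpha_{2k}\geq 2$, let $G=C(\alpha_1,\ldots,\alpha_{2k})$, and let $Q_{2k}(\epsilon(G))$ be the quotient matrix described below. Then $0$ is a simple eigenvalue of $Q_{2k}(\epsilon(G))$ if and only if $\alpha_2=1$.
   Context: For a positive integer $\alpha$, $K_\alpha$ is the complete graph on $\alpha$ vertices and $\overline{H}$ denotes the complement of a graph $H$. For positive integers $\alpha_1,\ldots,\alpha_l$ the graph $C(\alpha_1,\ldots,\alpha_l)$ is defined recursively by $C(\alpha_1)=\overline{K_{\alpha_1}}$ and $C(\alpha_1,\ldots,\alpha_i)=\overline{C(\alpha_1,\ldots,\alpha_{i-1})\cup K_{\alpha_i}}$ for $2\leq i\leq l$ (disjoint union, then complement). Let $V_1$ be the vertex set of $C(\alpha_1)$ and, for $i\geq 2$, $V_i$ the set of the $\alpha_i$ vertices of the copy of $K_{\alpha_i}$ added at step $i$; so $V(G)=V_1\cup\cdots\cup V_{2k}$, $|V_i|=\alpha_i$. For a connected graph $G$ with distance $d(u,v)$ and eccentricity $e(u)=\max_v d(u,v)$, the eccentricity matrix $\epsilon(G)$ has $(u,v)$-entry $d(u,v)$ if $d(u,v)=\min\{e(u),e(v)\}$ and $0$ otherwise. $Q_{2k}(\epsilon(G))=(q_{ij})_{1\le i,j\le 2k}$ is the quotient matrix of $\epsilon(G)$ with respect to the partition $V_1,\ldots,V_{2k}$: $q_{ij}=\sum_{u\in V_j}\epsilon(G)_{vu}$ for any $v\in V_i$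 (this is independent of $v$). Explicitly: $q_{2k,2k}=2(\alpha_{2k}-1)$ and all other entries of row $2k$ and column $2k$ are $0$; for $i,j\leq 2k-1$: if $i$ is even, $q_{ij}=0$ for $j<i$, $q_{ii}=2(\alpha_i-1)$; if $i$ is odd, $q_{ij}=2\alpha_j$ for $j<i$, $q_{ii}=0$; and for $j>i$ (any $i$), $q_{ij}=2\alpha_j$ if $j$ is odd and $q_{ij}=0$ if $j$ is even. -}

module Defs where

open import Data.Bool using (Bool; true; false; not; if_then_else_; _∧_; _∨_)
open import Data.Nat as ℕ using (ℕ; zero; suc; _∸_; _≡ᵇ_; _<ᵇ_)
open import Data.Integer as ℤ using (ℤ; +_; _+_; _*_; -_)
open import Data.Fin using (Fin; zero; suc; toℕ; punchIn)
open import Data.List using (List; []; _∷_; map)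
open import Data.Product using (Σ; _×_)
open import Relation.Binary.PropositionalEquality using (_≡_; _≢_)

oddᵇ : ℕ → Bool
oddᵇ zero    = false
oddᵇ (suc n) = not (oddᵇ n)

-- The quotient matrix Q_{2k}(ε(G)) of G = C(α₁,…,α_{2k}).
-- α is indexed 1-based: α i is α_i for 1 ≤ i ≤ 2k (other values unused).

Q : (k : ℕ) → (α : ℕ → ℕ) → Fin (2 ℕ.* k) → Fin (2 ℕ.* k) → ℕ
Q k α i j =
  let I = suc (toℕ i)
      J = suc (toℕ j)
      N = 2 ℕ.* k
  in if (I ≡ᵇ N) ∨ (J ≡ᵇ N)
     then (if (I ≡ᵇ N) ∧ (J ≡ᵇ N) then 2 ℕ.* (α N ∸ 1) else 0)
     else if J <ᵇ I
     then (if oddᵇ I then 2 ℕ.* α J else 0)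
     else if I ≡ᵇ J
     then (if oddᵇ I then 0 else 2 ℕ.* (α I ∸ 1))
     else (if oddᵇ J then 2 ℕ.* α J else 0)

-- Polynomials over ℤ as coefficient lists (lowest degree first).

Poly : Set
Poly = List ℤ

infixl 6 _+ₚ_
infixl 7 _*ₚ_

_+ₚ_ : Poly → Poly → Poly
[]      +ₚ q       = q
(a ∷ p) +ₚ []      = a ∷ p
(a ∷ p) +ₚ (b ∷ q) = (a + b) ∷ (p +ₚ q)

scaleₚ : ℤ → Poly → Poly
scaleₚ a = map (a *_)

_*ₚ_ : Poly → Poly → Poly
[]      *ₚ q = []
(a ∷ p) *ₚ q = scaleₚ a q +ₚ (+ 0 ∷ (p *ₚ q))

constₚ : ℤ → Poly
constₚ a = a ∷ []

Xₚ : Poly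
Xₚ = + 0 ∷ + 1 ∷ []

coeff : Poly → ℕ → ℤ
coeff []      _       = + 0
coeff (a ∷ p) zero    = a
coeff (a ∷ p) (suc n) = coeff p n

_≈ₚ_ : Poly → Poly → Set
p ≈ₚ q = ∀ m → coeff p m ≡ coeff q m

eval : Poly → ℤ → ℤ
eval []      x = + 0
eval (a ∷ p) x = a + x * eval p x

sumFinₚ : (n : ℕ) → (Fin n → Poly) → Poly
sumFinₚ zero    f = []
sumFinₚ (suc n) f = f zero +ₚ sumFinₚ n (λ j → f (suc j))

sign : ℕ → ℤ
sign n = if oddᵇ n then - (+ 1) else + 1

det : (n : ℕ) → (Fin n → Fin n → Poly) → Poly
det zero    M = constₚ (+ 1)
det (suc n) M =
  sumFinₚ (suc n) (λ j →
    scaleₚ (sign (toℕ j))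
      (M zero j *ₚ det n (λ r c → M (suc r) (punchIn j c))))

charPoly : (n : ℕ) → (Fin n → Fin n → ℤ) → Poly
charPoly n A = det n (λ i j →
  (if toℕ i ≡ᵇ toℕ j then Xₚ else []) +ₚ constₚ (- A i j))

-- λ is a simple eigenvalue of A: λ is a root of the characteristic
-- polynomial of algebraic multiplicity exactly one, i.e.
-- charPoly A = (x - λ) q with q(λ) ≠ 0.
SimpleEigenvalue : (n : ℕ) → (Fin n → Fin n → ℤ) → ℤ → Set
SimpleEigenvalue n A λ₀ =
  Σ Poly (λ q → (charPoly n A ≈ₚ ((constₚ (- λ₀) +ₚ (+ 0 ∷ + 1 ∷ [])) *ₚ q))
              × eval q λ₀ ≢ + 0)

Qℤ : (k : ℕ) → (α : ℕ → ℕ) → Fin (2 ℕ.* k) → Fin (2 ℕ.* k) → ℤ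
Qℤ k α i j = + (Q k α i j)

{-# OPTIONS --safe #-}
module Submission where

-- Zero is a simple eigenvalue iff the characteristic polynomial c has c(0) = 0 ≠ c′(0), so it
-- suffices to compute det(xI − Q) in the dual numbers ℤ[x]/(x²). Replacing the first column of
-- xI − Q by (p, 0, q, 0, q, …) gives a determinant Δ(p, q). Subtracting row 2 from row 1 and
-- row 3 from row 2 leaves two short rows, and expanding along them expresses Δ(p, q) for
-- (α₁, …, α_N) through χ = Δ(x, −2α₃) and η = Δ(1, 1) for (α₃, …, α_N). Put
-- τ = χ(0) − 2α₃ η(0); then c(0) = −2α₁ · 2(α₂ − 1) · τ, and c′(0) = (2α₁ + 2α₂) τ if α₂ = 1.
-- By induction on N, with base case N = 2 using α_N ≥ 2, τ and η(0) are non-zero with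
-- opposite signs; in particular τ ≠ 0.

open import Level using (0ℓ)
open import Algebra.Core using (Op₁; Op₂)
open import Algebra.Structures using (IsCommutativeRing)
open import Algebra.Bundles using (CommutativeRing)
open import Data.Bool as Bool using (true; false; if_then_else_; _∧_; _∨_)
open import Data.Fin using (Fin; zero; suc; toℕ; punchIn; lift)
open import Data.Nat using (ℕ; zero; suc)
open import Function using (_∘_)
open import Relation.Binary.PropositionalEquality
open import Defs using (oddᵇ)

module Determinant {A : Set} {add mul : Op₂ A} {neg : Op₁ A} {0ᴬ 1ᴬ : A}
  (isCommutativeRing : IsCommutativeRing _≡_ add mul neg 0ᴬ 1ᴬ) where

  commutativeRing : CommutativeRing 0ℓ 0ℓ
  commutativeRing = record { isCommutativeRing = isCommutativeRing }

  open CommutativeRing commutativeRing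
    using ( _+_; _*_; -_; _-_; 0#; 1#; +-assoc; +-identityˡ; +-identityʳ; -‿inverseʳ
          ; *-identityˡ; *-identityʳ; distribˡ; zeroˡ; zeroʳ; *-commutativeMonoid; semiring; ring)
  open import Algebra.Properties.Ring ring
    using (-1*x≈-x; -‿involutive; -‿distribˡ-*; -‿distribʳ-*; -‿+-comm; -0#≈0#; x[y-z]≈xy-xz; [y-z]x≈yx-zx)
  open import Algebra.Properties.Semiring.Sum semiring public using (sum; sum-cong-≗)
  open import Algebra.Properties.Semiring.Sum semiring using (∑-distrib-+; *-distribˡ-sum; sum-replicate-zero)
  open import Algebra.Solver.CommutativeMonoid *-commutativeMonoid using (solve; _⊕_; _⊜_)
  open ≡-Reasoning

  Matrix : ℕ → Set
  Matrix n = Fin n → Fin n → A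

  sgn : ℕ → A
  sgn n = if oddᵇ n then - 1# else 1#

  sgn-suc : ∀ n → sgn (suc n) ≡ - sgn n
  sgn-suc n with oddᵇ n
  ... | true  = sym (-‿involutive 1#)
  ... | false = refl

  minor : ∀ {n} → Matrix (suc n) → Fin (suc n) → Matrix n
  minor M j r c = M (suc r) (punchIn j c)

  det : (n : ℕ) → Matrix n → A
  det zero    M = 1#
  det (suc n) M = sum (λ j → sgn (toℕ j) * (M zero j * det n (minor M j)))

  det-cong : ∀ n {M N : Matrix n} → (∀ i j → M i j ≡ N i j) → det n M ≡ det n N
  det-cong zero    eq = refl
  det-cong (suc n) eq = sum-cong-≗ λ j →
    cong₂ (λ a b → sgn (toℕ j) * (a * b)) (eq zero j) (det-cong n (λ r c → eq (suc r) (punchIn j c)))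

  det₁ : ∀ M → det 1 M ≡ M zero zero
  det₁ M = trans (+-identityʳ _) (trans (*-identityˡ _) (*-identityʳ _))

  sum-neg : ∀ {n} (f : Fin n → A) → sum (λ i → - f i) ≡ - sum f
  sum-neg f = begin
    sum (λ i → - f i)       ≡⟨ sum-cong-≗ (λ i → sym (-1*x≈-x (f i))) ⟩
    sum (λ i → - 1# * f i)  ≡⟨ sym (*-distribˡ-sum (- 1#) f) ⟩
    - 1# * sum f            ≡⟨ -1*x≈-x (sum f) ⟩
    - sum f                 ∎

  sum-zero : ∀ {n} (f : Fin n → A) → (∀ i → f i ≡ 0#) → sum f ≡ 0#
  sum-zero {n} f eq = trans (sum-cong-≗ eq) (sum-replicate-zero n)

  private
    +-cancel-neg : ∀ a b → a + (- a + b) ≡ b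
    +-cancel-neg a b = begin
      a + (- a + b)  ≡⟨ sym (+-assoc a (- a) b) ⟩
      a + - a + b    ≡⟨ cong (_+ b) (-‿inverseʳ a) ⟩
      0# + b         ≡⟨ +-identityˡ b ⟩
      b              ∎

    neg-expansion : ∀ s a b f r → - s * (a * (b * f + - r)) ≡ - (b * (s * (a * f))) + s * (a * r)
    neg-expansion s a b f r = begin
        - s * (a * (b * f + - r))
      ≡⟨ sym (-‿distribˡ-* s _) ⟩
        - (s * (a * (b * f + - r)))
      ≡⟨ cong -_ (trans (cong (s *_) (distribˡ a (b * f) (- r))) (distribˡ s _ _)) ⟩
        - (s * (a * (b * f)) + s * (a * - r))
      ≡⟨ cong₂ (λ x y → - (x + y))
           (solve 4 (λ s a b f → (s ⊕ (a ⊕ (b ⊕ f))) ⊜ (b ⊕ (s ⊕ (a ⊕ f)))) refl s a b f)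
           (trans (cong (s *_) (sym (-‿distribʳ-* a r))) (sym (-‿distribʳ-* s (a * r)))) ⟩
        - (b * (s * (a * f)) + - (s * (a * r)))
      ≡⟨ sym (-‿+-comm _ _) ⟩
        - (b * (s * (a * f))) + - - (s * (a * r))
      ≡⟨ cong (- (b * (s * (a * f))) +_) (-‿involutive _) ⟩
        - (b * (s * (a * f))) + s * (a * r)
      ∎

  Extensional : ∀ {m n} → ((Fin m → Fin n) → A) → Set
  Extensional F = ∀ {σ τ} → σ ≗ τ → F σ ≡ F τ

  -- Expansion of a determinant along its first two rows, both equal to m; F σ stands for the
  -- minor on the columns σ.
  doubleExpansion : ∀ n → (Fin (suc (suc n)) → A) → ((Fin n → Fin (suc (suc n))) → A) → A
  doubleExpansion n m F = sum λ j → sgn (toℕ j) * (m j * sum λ l →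
    sgn (toℕ l) * (m (punchIn j l) * F (punchIn j ∘ punchIn l)))

  -- The terms with j = 0 cancel against the terms with j > 0, l = 0; the remaining terms form
  -- the same double expansion with column 0 deleted.
  doubleExpansion≡0 : ∀ n (m : Fin (suc (suc n)) → A) (F : (Fin n → Fin (suc (suc n))) → A) →
                      Extensional F → doubleExpansion n m F ≡ 0#
  doubleExpansion≡0 n m F ext = begin
      doubleExpansion n m F
    ≡⟨ cong₂ _+_ (*-identityˡ (m zero * sum A₀)) (sum-cong-≗ term-split) ⟩
      m zero * sum A₀ + sum (λ j → - (m zero * A₀ j) + Y j)
    ≡⟨ cong (m zero * sum A₀ +_) (∑-distrib-+ (λ j → - (m zero * A₀ j)) Y) ⟩
      m zero * sum A₀ + (sum (λ j → - (m zero * A₀ j)) + sum Y)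
    ≡⟨ cong (λ z → m zero * sum A₀ + (z + sum Y))
         (trans (sum-neg (λ j → m zero * A₀ j)) (cong -_ (sym (*-distribˡ-sum (m zero) A₀)))) ⟩
      m zero * sum A₀ + (- (m zero * sum A₀) + sum Y)
    ≡⟨ +-cancel-neg (m zero * sum A₀) (sum Y) ⟩
      sum Y
    ≡⟨ remainder≡0 n m F ext ⟩
      0#
    ∎
    where
    A₀ A₀′ : Fin (suc n) → A
    A₀ l = sgn (toℕ l) * (m (suc l) * F (suc ∘ punchIn l))
    A₀′ l = F (suc ∘ punchIn l)
    X : Fin (suc n) → Fin n → A
    X j l = m (suc (punchIn j l)) * F (punchIn (suc j) ∘ punchIn (suc l))
    Y : Fin (suc n) → A
    Y j = sgn (toℕ j) * (m (suc j) * sum (λ l → sgn (toℕ l) * X j l))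
    term-split : ∀ j → sgn (suc (toℕ j)) * (m (suc j) * (1# * (m zero * A₀′ j) + sum (λ l → sgn (suc (toℕ l)) * X j l)))
                ≡ - (m zero * A₀ j) + Y j
    term-split j = begin
        sgn (suc (toℕ j)) * (m (suc j) * (1# * (m zero * A₀′ j) + sum (λ l → sgn (suc (toℕ l)) * X j l)))
      ≡⟨ cong₂ (λ s r → s * (m (suc j) * r)) (sgn-suc (toℕ j))
           (cong₂ _+_ (*-identityˡ _)
             (sum-cong-≗ (λ l → trans (cong (_* X j l) (sgn-suc (toℕ l))) (sym (-‿distribˡ-* _ _))))) ⟩
        - sgn (toℕ j) * (m (suc j) * (m zero * A₀′ j + sum (λ l → - (sgn (toℕ l) * X j l))))
      ≡⟨ cong (λ r → - sgn (toℕ j) * (m (suc j) * (m zero * A₀′ j + r))) (sum-neg (λ l → sgn (toℕ l) * X j l)) ⟩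
        - sgn (toℕ j) * (m (suc j) * (m zero * A₀′ j + - sum (λ l → sgn (toℕ l) * X j l)))
      ≡⟨ neg-expansion (sgn (toℕ j)) (m (suc j)) (m zero) (A₀′ j) (sum (λ l → sgn (toℕ l) * X j l)) ⟩
        - (m zero * A₀ j) + Y j
      ∎
    remainder≡0 : ∀ n (m : Fin (suc (suc n)) → A) (F : (Fin n → Fin (suc (suc n))) → A) → Extensional F →
      sum (λ j → sgn (toℕ j) * (m (suc j) * sum (λ l → sgn (toℕ l) *
        (m (suc (punchIn j l)) * F (punchIn (suc j) ∘ punchIn (suc l)))))) ≡ 0#
    remainder≡0 zero    m F ext =
      sum-zero (λ j → sgn (toℕ j) * (m (suc j) * 0#)) (λ j → trans (cong (sgn (toℕ j) *_) (zeroʳ _)) (zeroʳ _))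
    remainder≡0 (suc n) m F ext = begin
        sum (λ j → sgn (toℕ j) * (m (suc j) * sum (λ l → sgn (toℕ l) *
          (m (suc (punchIn j l)) * F (punchIn (suc j) ∘ punchIn (suc l))))))
      ≡⟨ sum-cong-≗ (λ j → cong (λ z → sgn (toℕ j) * (m (suc j) * z)) (sum-cong-≗ λ l →
           cong (λ z → sgn (toℕ l) * (m (suc (punchIn j l)) * z))
             (ext {punchIn (suc j) ∘ punchIn (suc l)} {lift 1 (punchIn j ∘ punchIn l)} λ { zero → refl ; (suc c) → refl }))) ⟩
        doubleExpansion n (m ∘ suc) (F ∘ lift 1)
      ≡⟨ doubleExpansion≡0 n (m ∘ suc) (F ∘ lift 1) (λ eq → ext λ { zero → refl ; (suc c) → cong suc (eq c) }) ⟩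
        0#
      ∎

  det-equal-rows₀₁ : ∀ n (M : Matrix (suc (suc n))) → (∀ j → M (suc zero) j ≡ M zero j) → det (suc (suc n)) M ≡ 0#
  det-equal-rows₀₁ n M eq = trans
    (sum-cong-≗ λ j → cong (λ z → sgn (toℕ j) * (M zero j * z)) (sum-cong-≗ λ l →
      cong (λ z → sgn (toℕ l) * (z * det n (minor (minor M j) l))) (eq (punchIn j l))))
    (doubleExpansion≡0 n (M zero) (λ σ → det n (λ r c → M (suc (suc r)) (σ c)))
      (λ eq → det-cong n (λ r c → cong (M (suc (suc r))) (eq c))))

  det-row₀-minus-row₁ : ∀ n (M M′ : Matrix (suc (suc n))) →
    (∀ j → M′ zero j ≡ M zero j - M (suc zero) j) → (∀ i j → M′ (suc i) j ≡ M (suc i) j) →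
    det (suc (suc n)) M′ ≡ det (suc (suc n)) M
  det-row₀-minus-row₁ n M M′ row₀ rows = begin
      det (suc (suc n)) M′
    ≡⟨ sum-cong-≗ (λ j → cong₂ (λ a b → sgn (toℕ j) * (a * b)) (row₀ j) (det-cong (suc n) λ r c → rows r (punchIn j c))) ⟩
      sum (λ j → sgn (toℕ j) * ((M zero j - M (suc zero) j) * det (suc n) (minor M j)))
    ≡⟨ sum-cong-≗ (λ j → trans (cong (sgn (toℕ j) *_) ([y-z]x≈yx-zx (minor-det j) (M zero j) (M (suc zero) j)))
                                (x[y-z]≈xy-xz (sgn (toℕ j)) (M zero j * minor-det j) (M (suc zero) j * minor-det j))) ⟩
      sum (λ j → term M j + - term M₁ j)
    ≡⟨ ∑-distrib-+ (term M) (λ j → - term M₁ j) ⟩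
      det (suc (suc n)) M + sum (λ j → - term M₁ j)
    ≡⟨ cong (det (suc (suc n)) M +_) (trans (sum-neg (term M₁)) (cong -_ (det-equal-rows₀₁ n M₁ (λ j → refl)))) ⟩
      det (suc (suc n)) M + - 0#
    ≡⟨ trans (cong (det (suc (suc n)) M +_) -0#≈0#) (+-identityʳ _) ⟩
      det (suc (suc n)) M
    ∎
    where
    M₁ : Matrix (suc (suc n))
    M₁ zero    = M (suc zero)
    M₁ (suc i) = M (suc i)
    minor-det : Fin (suc (suc n)) → A
    minor-det j = det (suc n) (minor M j)
    term : Matrix (suc (suc n)) → Fin (suc (suc n)) → A
    term K j = sgn (toℕ j) * (K zero j * minor-det j)

  det-row₁-minus-row₂ : ∀ n (M M′ : Matrix (suc (suc (suc n)))) →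
    (∀ j → M′ zero j ≡ M zero j) → (∀ j → M′ (suc zero) j ≡ M (suc zero) j - M (suc (suc zero)) j) →
    (∀ i j → M′ (suc (suc i)) j ≡ M (suc (suc i)) j) →
    det (suc (suc (suc n))) M′ ≡ det (suc (suc (suc n))) M
  det-row₁-minus-row₂ n M M′ row₀ row₁ rows = sum-cong-≗ λ j →
    cong₂ (λ a b → sgn (toℕ j) * (a * b)) (row₀ j)
      (det-row₀-minus-row₁ n (minor M j) (minor M′ j) (λ c → row₁ (punchIn j c)) (λ r c → rows r (punchIn j c)))

  det-expand-row₀ : ∀ n (M : Matrix (suc (suc n))) → (∀ j → M zero (suc (suc j)) ≡ 0#) →
    det (suc (suc n)) M ≡ M zero zero * det (suc n) (minor M zero) - M zero (suc zero) * det (suc n) (minor M (suc zero))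
  det-expand-row₀ n M zeros = begin
      det (suc (suc n)) M
    ≡⟨ cong₂ (λ x y → x + (- 1# * b + y)) (*-identityˡ a) (sum-zero (λ j → term (suc (suc j))) λ j →
         trans (cong (λ z → sgn (toℕ (suc (suc j))) * (z * minor-det (suc (suc j)))) (zeros j))
           (trans (cong (sgn (toℕ (suc (suc j))) *_) (zeroˡ _)) (zeroʳ _))) ⟩
      a + (- 1# * b + 0#)
    ≡⟨ cong (a +_) (trans (+-identityʳ _) (-1*x≈-x b)) ⟩
      a - b
    ∎
    where
    minor-det : Fin (suc (suc n)) → A
    minor-det j = det (suc n) (minor M j)
    term : Fin (suc (suc n)) → A
    term j = sgn (toℕ j) * (M zero j * minor-det j)
    a b : A
    a = M zero zero * minor-det zero
    b = M zero (suc zero) * minor-det (suc zero)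

  det-scale-column₀ : ∀ n c (M N : Matrix (suc n)) →
    (∀ i → N i zero ≡ c * M i zero) → (∀ i j → N i (suc j) ≡ M i (suc j)) →
    det (suc n) N ≡ c * det (suc n) M
  det-scale-column₀ n c M N col₀ cols =
    trans (sum-cong-≗ (term-scaled n M N col₀ cols)) (sym (*-distribˡ-sum c (λ j → sgn (toℕ j) * (M zero j * det n (minor M j)))))
    where
    term-scaled : ∀ n (M N : Matrix (suc n)) →
      (∀ i → N i zero ≡ c * M i zero) → (∀ i j → N i (suc j) ≡ M i (suc j)) → ∀ j → sgn (toℕ j) * (N zero j * det n (minor N j)) ≡ c * (sgn (toℕ j) * (M zero j * det n (minor M j)))
    term-scaled n M N col₀ cols zero = begin
        1# * (N zero zero * det n (minor N zero))
      ≡⟨ cong₂ (λ a b → 1# * (a * b)) (col₀ zero) (det-cong n (λ r k → cols (suc r) k)) ⟩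
        1# * (c * M zero zero * det n (minor M zero))
      ≡⟨ solve 4 (λ s c a d → (s ⊕ ((c ⊕ a) ⊕ d)) ⊜ (c ⊕ (s ⊕ (a ⊕ d)))) refl
           1# c (M zero zero) (det n (minor M zero)) ⟩
        c * (1# * (M zero zero * det n (minor M zero)))
      ∎
    term-scaled (suc n) M N col₀ cols (suc j) = begin
        sgn (toℕ (suc j)) * (N zero (suc j) * det (suc n) (minor N (suc j)))
      ≡⟨ cong₂ (λ a b → sgn (toℕ (suc j)) * (a * b)) (cols zero j)
           (det-scale-column₀ n c (minor M (suc j)) (minor N (suc j)) (col₀ ∘ suc) (λ i k → cols (suc i) (punchIn j k))) ⟩
        sgn (toℕ (suc j)) * (M zero (suc j) * (c * det (suc n) (minor M (suc j))))
      ≡⟨ solve 4 (λ s a c d → (s ⊕ (a ⊕ (c ⊕ d))) ⊜ (c ⊕ (s ⊕ (a ⊕ d)))) refl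
           (sgn (toℕ (suc j))) (M zero (suc j)) c (det (suc n) (minor M (suc j))) ⟩
        c * (sgn (toℕ (suc j)) * (M zero (suc j) * det (suc n) (minor M (suc j))))
      ∎

module DualNumbers where

  open import Data.Integer as ℤ using (ℤ; +_; _+_; _*_; -_)
  import Data.Integer.Properties as ℤP
  open import Data.Integer.Tactic.RingSolver using (solve-∀)
  open import Data.Maybe using (Maybe; just; nothing)
  open import Data.Product using (_,_)
  open import Relation.Nullary using (yes; no)
  open import Tactic.RingSolver.Core.AlmostCommutativeRing using (AlmostCommutativeRing; fromCommutativeRing)

  record Dual : Set where
    constructor _+ε_
    field
      coeff₀ coeff₁ : ℤ

  open Dual public

  infix  5 _+ε_
  infixl 6 _⊕_ _⊖_
  infixl 7 _⊗_
  infix  8 ⊝_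

  _⊕_ : Dual → Dual → Dual
  x ⊕ y = (coeff₀ x + coeff₀ y) +ε (coeff₁ x + coeff₁ y)

  _⊗_ : Dual → Dual → Dual
  x ⊗ y = (coeff₀ x * coeff₀ y) +ε (coeff₀ x * coeff₁ y + coeff₁ x * coeff₀ y)

  ⊝_ : Dual → Dual
  ⊝ x = (- coeff₀ x) +ε (- coeff₁ x)

  _⊖_ : Dual → Dual → Dual
  x ⊖ y = x ⊕ ⊝ y

  ι : ℤ → Dual
  ι a = a +ε + 0

  𝟘 𝟙 ε : Dual
  𝟘 = ι (+ 0)
  𝟙 = ι (+ 1)
  ε = + 0 +ε + 1

  Dual-isCommutativeRing : IsCommutativeRing _≡_ _⊕_ _⊗_ ⊝_ 𝟘 𝟙
  Dual-isCommutativeRing = record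
    { isRing = record
      { +-isAbelianGroup = record
        { isGroup = record
          { isMonoid = record
            { isSemigroup = record
              { isMagma = record { isEquivalence = isEquivalence ; ∙-cong = cong₂ _⊕_ }
              ; assoc = λ x y z →
                  cong₂ _+ε_ (ℤP.+-assoc (coeff₀ x) (coeff₀ y) (coeff₀ z)) (ℤP.+-assoc (coeff₁ x) (coeff₁ y) (coeff₁ z))
              }
            ; identity = (λ x → cong₂ _+ε_ (ℤP.+-identityˡ (coeff₀ x)) (ℤP.+-identityˡ (coeff₁ x)))
                       , (λ x → cong₂ _+ε_ (ℤP.+-identityʳ (coeff₀ x)) (ℤP.+-identityʳ (coeff₁ x)))
            }
          ; inverse = (λ x → cong₂ _+ε_ (ℤP.+-inverseˡ (coeff₀ x)) (ℤP.+-inverseˡ (coeff₁ x)))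
                    , (λ x → cong₂ _+ε_ (ℤP.+-inverseʳ (coeff₀ x)) (ℤP.+-inverseʳ (coeff₁ x)))
          ; ⁻¹-cong = cong ⊝_
          }
        ; comm = λ x y → cong₂ _+ε_ (ℤP.+-comm (coeff₀ x) (coeff₀ y)) (ℤP.+-comm (coeff₁ x) (coeff₁ y))
        }
      ; *-cong = cong₂ _⊗_
      ; *-assoc = λ { (a +ε a′) (b +ε b′) (c +ε c′) → cong₂ _+ε_ (ℤP.*-assoc a b c) (*-assoc₁ a a′ b b′ c c′) }
      ; *-identity = (λ { (a +ε a′) → cong₂ _+ε_ (ℤP.*-identityˡ a) (*-identityˡ₁ a a′) })
                   , (λ { (a +ε a′) → cong₂ _+ε_ (ℤP.*-identityʳ a) (*-identityʳ₁ a a′) })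
      ; distrib = (λ { (a +ε a′) (b +ε b′) (c +ε c′) → cong₂ _+ε_ (ℤP.*-distribˡ-+ a b c) (distribˡ₁ a a′ b b′ c c′) })
                , (λ { (a +ε a′) (b +ε b′) (c +ε c′) → cong₂ _+ε_ (ℤP.*-distribʳ-+ a b c) (distribʳ₁ a a′ b b′ c c′) })
      }
    ; *-comm = λ { (a +ε a′) (b +ε b′) → cong₂ _+ε_ (ℤP.*-comm a b) (*-comm₁ a a′ b b′) }
    }
    where
    *-assoc₁ : ∀ a a′ b b′ c c′ → (a * b) * c′ + (a * b′ + a′ * b) * c ≡ a * (b * c′ + b′ * c) + a′ * (b * c)
    *-assoc₁ = solve-∀
    *-identityˡ₁ : ∀ a a′ → + 1 * a′ + + 0 * a ≡ a′
    *-identityˡ₁ = solve-∀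
    *-identityʳ₁ : ∀ a a′ → a * + 0 + a′ * + 1 ≡ a′
    *-identityʳ₁ = solve-∀
    distribˡ₁ : ∀ a a′ b b′ c c′ → a * (b′ + c′) + a′ * (b + c) ≡ (a * b′ + a′ * b) + (a * c′ + a′ * c)
    distribˡ₁ = solve-∀
    distribʳ₁ : ∀ a a′ b b′ c c′ → (b + c) * a′ + (b′ + c′) * a ≡ (b * a′ + b′ * a) + (c * a′ + c′ * a)
    distribʳ₁ = solve-∀
    *-comm₁ : ∀ a a′ b b′ → a * b′ + a′ * b ≡ b * a′ + b′ * a
    *-comm₁ = solve-∀

  Dual-commutativeRing : CommutativeRing 0ℓ 0ℓ
  Dual-commutativeRing = record { isCommutativeRing = Dual-isCommutativeRing }

  Dual-ring : AlmostCommutativeRing 0ℓ 0ℓ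
  Dual-ring = fromCommutativeRing Dual-commutativeRing is𝟘?
    where
    is𝟘? : ∀ x → Maybe (𝟘 ≡ x)
    is𝟘? (a +ε b) with a ℤ.≟ + 0 | b ℤ.≟ + 0
    ... | yes refl | yes refl = just refl
    ... | _        | _        = nothing

module Truncation where

  open import Data.Integer as ℤ using (ℤ; +_; _+_; _*_; -_)
  import Data.Integer.Properties as ℤP
  open import Data.Integer.Tactic.RingSolver using (solve-∀)
  open import Data.List using ([]; _∷_; drop)
  open import Data.Nat using (_≡ᵇ_)
  open import Data.Product using (_,_; _×_)
  open import Function.Bundles using (_⇔_; mk⇔)
  import Defs
  open Defs using (Poly; _+ₚ_; _*ₚ_; scaleₚ; constₚ; Xₚ; coeff; eval; sumFinₚ; sign; charPoly; SimpleEigenvalue)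
  open DualNumbers
  open Determinant Dual-isCommutativeRing using (sum; sum-cong-≗; sgn; minor; det; det-cong)
  open ≡-Reasoning

  jet : Poly → Dual
  jet p = coeff p 0 +ε coeff p 1

  coeff-+ₚ : ∀ p q m → coeff (p +ₚ q) m ≡ coeff p m + coeff q m
  coeff-+ₚ []      q       m       = sym (ℤP.+-identityˡ _)
  coeff-+ₚ (a ∷ p) []      zero    = sym (ℤP.+-identityʳ _)
  coeff-+ₚ (a ∷ p) []      (suc m) = sym (ℤP.+-identityʳ _)
  coeff-+ₚ (a ∷ p) (b ∷ q) zero    = refl
  coeff-+ₚ (a ∷ p) (b ∷ q) (suc m) = coeff-+ₚ p q m

  coeff-scaleₚ : ∀ a p m → coeff (scaleₚ a p) m ≡ a * coeff p m
  coeff-scaleₚ a []      m       = sym (ℤP.*-zeroʳ a)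
  coeff-scaleₚ a (b ∷ p) zero    = refl
  coeff-scaleₚ a (b ∷ p) (suc m) = coeff-scaleₚ a p m

  jet-+ₚ : ∀ p q → jet (p +ₚ q) ≡ jet p ⊕ jet q
  jet-+ₚ p q = cong₂ _+ε_ (coeff-+ₚ p q 0) (coeff-+ₚ p q 1)

  jet-scaleₚ : ∀ a p → jet (scaleₚ a p) ≡ ι a ⊗ jet p
  jet-scaleₚ a p = cong₂ _+ε_ (coeff-scaleₚ a p 0) (trans (coeff-scaleₚ a p 1) (lemma a (coeff p 0) (coeff p 1)))
    where
    lemma : ∀ a p₀ p₁ → a * p₁ ≡ a * p₁ + + 0 * p₀
    lemma = solve-∀

  jet-*ₚ : ∀ p q → jet (p *ₚ q) ≡ jet p ⊗ jet q
  jet-*ₚ []      q = cong₂ _+ε_ (sym (ℤP.*-zeroˡ (coeff q 0))) (lemma (coeff q 0) (coeff q 1))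
    where
    lemma : ∀ q₀ q₁ → + 0 ≡ + 0 * q₁ + + 0 * q₀
    lemma = solve-∀
  jet-*ₚ (a ∷ p) q = begin
      jet (scaleₚ a q +ₚ (+ 0 ∷ p *ₚ q))
    ≡⟨ jet-+ₚ (scaleₚ a q) (+ 0 ∷ p *ₚ q) ⟩
      jet (scaleₚ a q) ⊕ (+ 0 +ε coeff (p *ₚ q) 0)
    ≡⟨ cong₂ (λ x y → x ⊕ (+ 0 +ε y)) (jet-scaleₚ a q) (cong coeff₀ (jet-*ₚ p q)) ⟩
      ι a ⊗ jet q ⊕ (+ 0 +ε coeff p 0 * coeff q 0)
    ≡⟨ cong₂ _+ε_ (lemma₀ a (coeff q 0)) (lemma₁ a (coeff p 0) (coeff q 0) (coeff q 1)) ⟩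
      jet (a ∷ p) ⊗ jet q
    ∎
    where
    lemma₀ : ∀ a q₀ → a * q₀ + + 0 ≡ a * q₀
    lemma₀ = solve-∀
    lemma₁ : ∀ a p₀ q₀ q₁ → a * q₁ + + 0 * q₀ + p₀ * q₀ ≡ a * q₁ + p₀ * q₀
    lemma₁ = solve-∀

  jet-sumFinₚ : ∀ n (f : Fin n → Poly) → jet (sumFinₚ n f) ≡ sum (λ i → jet (f i))
  jet-sumFinₚ zero    f = refl
  jet-sumFinₚ (suc n) f =
    trans (jet-+ₚ (f zero) (sumFinₚ n (f ∘ suc))) (cong (jet (f zero) ⊕_) (jet-sumFinₚ n (f ∘ suc)))

  ι-sign : ∀ n → ι (sign n) ≡ sgn n
  ι-sign n with oddᵇ n
  ... | true  = refl
  ... | false = refl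

  jet-det : ∀ n (M : Fin n → Fin n → Poly) → jet (Defs.det n M) ≡ det n (λ i j → jet (M i j))
  jet-det zero    M = refl
  jet-det (suc n) M = trans (jet-sumFinₚ (suc n) (λ j → scaleₚ (sign (toℕ j)) (M zero j *ₚ Defs.det n (minorₚ j))))
                            (sum-cong-≗ λ j → begin
      jet (scaleₚ (sign (toℕ j)) (M zero j *ₚ Defs.det n (minorₚ j)))
    ≡⟨ jet-scaleₚ (sign (toℕ j)) (M zero j *ₚ Defs.det n (minorₚ j)) ⟩
      ι (sign (toℕ j)) ⊗ jet (M zero j *ₚ Defs.det n (minorₚ j))
    ≡⟨ cong₂ _⊗_ (ι-sign (toℕ j)) (jet-*ₚ (M zero j) (Defs.det n (minorₚ j))) ⟩
      sgn (toℕ j) ⊗ (jet (M zero j) ⊗ jet (Defs.det n (minorₚ j)))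
    ≡⟨ cong (λ d → sgn (toℕ j) ⊗ (jet (M zero j) ⊗ d)) (jet-det n (minorₚ j)) ⟩
      sgn (toℕ j) ⊗ (jet (M zero j) ⊗ det n (minor (λ r c → jet (M r c)) j))
    ∎)
    where
    minorₚ : Fin (suc n) → Fin n → Fin n → Poly
    minorₚ j r c = M (suc r) (punchIn j c)

  jet-charPoly : ∀ n A → jet (charPoly n A) ≡ det n (λ i j → - A i j +ε (if toℕ i ≡ᵇ toℕ j then + 1 else + 0))
  jet-charPoly n A = trans (jet-det n _) (det-cong n λ i j → jet-entry (toℕ i ≡ᵇ toℕ j) (- A i j))
    where
    jet-entry : ∀ b x → jet ((if b then Xₚ else []) +ₚ constₚ x) ≡ x +ε (if b then + 1 else + 0)
    jet-entry true  x = cong (_+ε + 1) (ℤP.+-identityˡ x)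
    jet-entry false x = refl

  coeff-Xₚ*ₚ-zero : ∀ q → coeff (Xₚ *ₚ q) 0 ≡ + 0
  coeff-Xₚ*ₚ-zero q = trans (coeff-+ₚ (scaleₚ (+ 0) q) (+ 0 ∷ (+ 1 ∷ []) *ₚ q) 0)
    (trans (ℤP.+-identityʳ _) (trans (coeff-scaleₚ (+ 0) q 0) (ℤP.*-zeroˡ (coeff q 0))))

  coeff-Xₚ*ₚ-suc : ∀ q m → coeff (Xₚ *ₚ q) (suc m) ≡ coeff q m
  coeff-Xₚ*ₚ-suc q m = begin
      coeff (scaleₚ (+ 0) q +ₚ (+ 0 ∷ (+ 1 ∷ []) *ₚ q)) (suc m)
    ≡⟨ coeff-+ₚ (scaleₚ (+ 0) q) (+ 0 ∷ (+ 1 ∷ []) *ₚ q) (suc m) ⟩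
      coeff (scaleₚ (+ 0) q) (suc m) + coeff (scaleₚ (+ 1) q +ₚ (+ 0 ∷ [])) m
    ≡⟨ cong₂ _+_ (trans (coeff-scaleₚ (+ 0) q (suc m)) (ℤP.*-zeroˡ (coeff q (suc m))))
                 (coeff-+ₚ (scaleₚ (+ 1) q) (+ 0 ∷ []) m) ⟩
      + 0 + (coeff (scaleₚ (+ 1) q) m + coeff (+ 0 ∷ []) m)
    ≡⟨ cong₂ (λ x y → + 0 + (x + y)) (trans (coeff-scaleₚ (+ 1) q m) (ℤP.*-identityˡ _)) (coeff-zero m) ⟩
      + 0 + (coeff q m + + 0)
    ≡⟨ trans (ℤP.+-identityˡ _) (ℤP.+-identityʳ _) ⟩
      coeff q m
    ∎
    where
    coeff-zero : ∀ m → coeff (+ 0 ∷ []) m ≡ + 0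
    coeff-zero zero    = refl
    coeff-zero (suc m) = refl

  eval-at-0 : ∀ q → eval q (+ 0) ≡ coeff q 0
  eval-at-0 []      = refl
  eval-at-0 (a ∷ q) = trans (cong (λ x → a + x) (ℤP.*-zeroˡ (eval q (+ 0)))) (ℤP.+-identityʳ a)

  coeff-drop₁ : ∀ p m → coeff (drop 1 p) m ≡ coeff p (suc m)
  coeff-drop₁ []      m = refl
  coeff-drop₁ (a ∷ p) m = refl

  simpleEigenvalue0⇔ : ∀ n A → let c = charPoly n A in
    SimpleEigenvalue n A (+ 0) ⇔ (coeff c 0 ≡ + 0 × coeff c 1 ≢ + 0)
  simpleEigenvalue0⇔ n A = mk⇔
    (λ (q , c≈xq , q₀≢0) →
      trans (c≈xq 0) (coeff-Xₚ*ₚ-zero q) ,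
      λ c₁≡0 → q₀≢0 (trans (eval-at-0 q) (trans (sym (coeff-Xₚ*ₚ-suc q 0)) (trans (sym (c≈xq 1)) c₁≡0))))
    (λ (c₀≡0 , c₁≢0) →
      drop 1 c ,
      (λ { zero    → trans c₀≡0 (sym (coeff-Xₚ*ₚ-zero (drop 1 c)))
         ; (suc m) → trans (sym (coeff-drop₁ c m)) (sym (coeff-Xₚ*ₚ-suc (drop 1 c) m)) }) ,
      λ e → c₁≢0 (trans (sym (coeff-drop₁ c 0)) (trans (sym (eval-at-0 (drop 1 c))) e)))
    where
    c = charPoly n A

module QuotientMatrix where

  open import Data.Empty using (⊥-elim)
  open import Data.Integer as ℤ using (ℤ; +_; _+_; _*_; -_; _-_)
  import Data.Integer.Properties as ℤP
  open import Data.Integer.Tactic.RingSolver using (solve-∀)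
  open import Data.Nat as ℕ using (_≡ᵇ_; _<ᵇ_; _∸_; _≤_; s≤s; z≤n)
  import Data.Nat.Properties as ℕP
  open import Data.Sum using (_⊎_; inj₁; inj₂; [_,_]′)
  open import Function.Bundles using (_⇔_; mk⇔)
  open import Defs using (Qℤ; charPoly)
  import Tactic.RingSolver
  open DualNumbers
  open Truncation using (jet; jet-charPoly)
  open CommutativeRing Dual-commutativeRing using (*-identityʳ; zeroʳ; -‿inverseʳ)
  open Determinant Dual-isCommutativeRing
    using ( Matrix; det; det-cong; det₁; minor
          ; det-row₀-minus-row₁; det-row₁-minus-row₂; det-expand-row₀; det-scale-column₀)
  open ≡-Reasoning

  -- Defs.Q with the size 2k generalised to N and indices in ℕ (0-based):
  -- Q k α i j = Qn (2 * k) α (toℕ i) (toℕ j) by definition.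
  Qn : ℕ → (ℕ → ℕ) → ℕ → ℕ → ℕ
  Qn N α i j =
    let I = suc i
        J = suc j
    in if (I ≡ᵇ N) ∨ (J ≡ᵇ N)
       then (if (I ≡ᵇ N) ∧ (J ≡ᵇ N) then 2 ℕ.* (α N ∸ 1) else 0)
       else if J <ᵇ I
       then (if oddᵇ I then 2 ℕ.* α J else 0)
       else if I ≡ᵇ J
       then (if oddᵇ I then 0 else 2 ℕ.* (α I ∸ 1))
       else (if oddᵇ J then 2 ℕ.* α J else 0)

  charEntry : ℕ → (ℕ → ℕ) → ℕ → ℕ → Dual
  charEntry N α i j = - + Qn N α i j +ε (if i ≡ᵇ j then + 1 else + 0)

  shift : (ℕ → ℕ) → ℕ → ℕ
  shift α i = α (suc (suc i))

  charEntry-shift : ∀ N α i j → charEntry (suc (suc N)) α (suc (suc i)) (suc (suc j)) ≡ charEntry N (shift α) i j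
  charEntry-shift N α i j with oddᵇ i | oddᵇ j
  ... | true  | true  = refl
  ... | true  | false = refl
  ... | false | true  = refl
  ... | false | false = refl

  column₀ : Dual → Dual → ℕ → Dual
  column₀ p q zero    = p
  column₀ p q (suc i) = if oddᵇ i then q else 𝟘

  twice : ℕ → ℤ
  twice a = + (2 ℕ.* a)

  charEntry-column₀ : ∀ n α → oddᵇ n ≡ false →
    ∀ i → charEntry (suc (suc n)) α i 0 ≡ column₀ ε (⊝ ι (twice (α 1))) i
  charEntry-column₀ n α n-even zero = refl
  charEntry-column₀ n α n-even (suc i) with i ≡ᵇ n in i≡ᵇn
  ... | true rewrite ℕP.≡ᵇ⇒≡ i n (subst Bool.T (sym i≡ᵇn) _) | n-even = refl
  ... | false with oddᵇ i
  ...   | true  = refl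
  ...   | false = refl

  withColumn₀ : ℕ → (ℕ → ℕ) → Dual → Dual → ℕ → ℕ → Dual
  withColumn₀ N α p q i zero    = column₀ p q i
  withColumn₀ N α p q i (suc j) = charEntry N α i (suc j)

  -- Δ N α p q is det(xI − Q) mod x² with column 0 replaced by column₀ p q. It is opaque so that
  -- the type checker never unfolds a determinant while comparing integer coefficients.
  opaque
    Δ : (N : ℕ) → (ℕ → ℕ) → Dual → Dual → Dual
    Δ N α p q = det N (λ i j → withColumn₀ N α p q (toℕ i) (toℕ j))

  opaque
    unfolding Δ

    Δ-unfold : ∀ N α p q → Δ N α p q ≡ det N (λ i j → withColumn₀ N α p q (toℕ i) (toℕ j))
    Δ-unfold N α p q = refl

  χ η : (N : ℕ) → (ℕ → ℕ) → Dual
  χ N α = Δ N α ε (⊝ ι (twice (α 1)))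
  η N α = Δ N α 𝟙 𝟙

  column₀-shift : ∀ p q r → column₀ p q (suc (suc r)) ≡ q ⊗ column₀ 𝟙 𝟙 r
  column₀-shift p q zero = sym (*-identityʳ q)
  column₀-shift p q (suc r) with oddᵇ r
  ... | true  = sym (*-identityʳ q)
  ... | false = sym (zeroʳ q)

  charEntry-column₁ : ∀ n α → oddᵇ n ≡ false → ∀ r →
    charEntry (suc (suc (suc (suc n)))) α (suc (suc r)) 1 ≡ ⊝ ι (twice (α 2)) ⊗ column₀ 𝟙 𝟙 r
  charEntry-column₁ n α n-even r with r ≡ᵇ suc n in r≡ᵇn
  ... | true rewrite ℕP.≡ᵇ⇒≡ r (suc n) (subst Bool.T (sym r≡ᵇn) _) | n-even = sym (zeroʳ (⊝ ι (twice (α 2))))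
  charEntry-column₁ n α n-even zero    | false = sym (*-identityʳ (⊝ ι (twice (α 2))))
  charEntry-column₁ n α n-even (suc r) | false with oddᵇ r
  ... | true  = sym (*-identityʳ (⊝ ι (twice (α 2))))
  ... | false = sym (zeroʳ (⊝ ι (twice (α 2))))

  τ : (N : ℕ) → (ℕ → ℕ) → ℤ
  τ N β = coeff₀ (χ N β) - twice (β 1) * coeff₀ (η N β)

  ±1*pos≢0 : ∀ {s u} → s ≡ + 1 ⊎ s ≡ - + 1 → 1 ≤ u → s * + u ≢ + 0
  ±1*pos≢0 (inj₁ refl) (s≤s z≤n) ()
  ±1*pos≢0 (inj₂ refl) (s≤s z≤n) ()

  record OppositeSigns (x y : ℤ) : Set where
    field
      s         : ℤ
      s≡±1      : s ≡ + 1 ⊎ s ≡ - + 1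
      ∣x∣ ∣y∣   : ℕ
      1≤∣x∣     : 1 ≤ ∣x∣
      1≤∣y∣     : 1 ≤ ∣y∣
      x≡s*∣x∣   : x ≡ s * + ∣x∣
      y≡-s*∣y∣  : y ≡ - (s * + ∣y∣)

    x≢0 : x ≢ + 0
    x≢0 x≡0 = ±1*pos≢0 s≡±1 1≤∣x∣ (trans (sym x≡s*∣x∣) x≡0)

  Invariant : ℕ → (ℕ → ℕ) → Set
  Invariant N β = OppositeSigns (τ N β) (coeff₀ (η N β))

  twice≢0 : ∀ {m} → 1 ≤ m → twice m ≢ + 0
  twice≢0 (s≤s z≤n) ()

  twice-+≢0 : ∀ {m} k → 1 ≤ m → twice m + twice k ≢ + 0
  twice-+≢0 k (s≤s z≤n) ()

  twice≡0⇒≡0 : ∀ m → twice m ≡ + 0 → m ≡ 0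
  twice≡0⇒≡0 zero    _  = refl
  twice≡0⇒≡0 (suc m) ()

  1≤twice : ∀ {m} → 1 ≤ m → 1 ≤ 2 ℕ.* m
  1≤twice (s≤s z≤n) = s≤s z≤n

  pos-sum-of-products : ∀ b c d e f → + b * + c + + d * + e * + f ≡ + (b ℕ.* c ℕ.+ d ℕ.* e ℕ.* f)
  pos-sum-of-products b c d e f = sym (begin
      + (b ℕ.* c ℕ.+ d ℕ.* e ℕ.* f)
    ≡⟨ ℤP.pos-+ (b ℕ.* c) (d ℕ.* e ℕ.* f) ⟩
      + (b ℕ.* c) + + (d ℕ.* e ℕ.* f)
    ≡⟨ cong₂ _+_ (ℤP.pos-* b c) (trans (ℤP.pos-* (d ℕ.* e) f) (cong (_* + f) (ℤP.pos-* d e))) ⟩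
      + b * + c + + d * + e * + f
    ∎)

  pos-* : ∀ a m → + a * + m ≡ + (a ℕ.* m)
  pos-* a m = sym (ℤP.pos-* a m)

  rearrange : ∀ p q Y A₂ A₃ S E →
    (p ⊖ 𝟘) ⊗ ((Y ⊖ ⊝ A₂) ⊗ S ⊖ (⊝ A₃ ⊖ ε) ⊗ (⊝ A₂ ⊗ E))
      ⊖ (𝟘 ⊖ Y) ⊗ ((𝟘 ⊖ q) ⊗ S ⊖ (⊝ A₃ ⊖ ε) ⊗ (q ⊗ E))
    ≡ p ⊗ (Y ⊗ S ⊕ A₂ ⊗ (S ⊖ (A₃ ⊕ ε) ⊗ E)) ⊖ q ⊗ (Y ⊗ (S ⊖ (A₃ ⊕ ε) ⊗ E))
  rearrange = Tactic.RingSolver.solve-∀ Dual-ring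

  module Step (n : ℕ) (α : ℕ → ℕ) (n-even : oddᵇ n ≡ false) where

    a₁ a₂ a₃ z : ℤ
    a₁ = twice (α 1)
    a₂ = twice (α 2)
    a₃ = twice (α 3)
    z  = twice (α 2 ∸ 1)

    Y S E T : Dual
    Y = charEntry (suc (suc (suc (suc n)))) α 1 1
    S = χ (suc (suc n)) (shift α)
    E = η (suc (suc n)) (shift α)
    T = S ⊖ (ι a₃ ⊕ ε) ⊗ E

    -- Rows 0 and 1 of W agree from column 2 on and rows 1 and 2 from column 3 on. After the two
    -- row subtractions, expanding along rows 0 and 1 leaves minors of the size-(N − 2) problem
    -- for shift α, one of them with its first column scaled.
    Δ-step : ∀ p q → Δ (suc (suc (suc (suc n)))) α p q ≡ p ⊗ (Y ⊗ S ⊕ ι a₂ ⊗ T) ⊖ q ⊗ (Y ⊗ T)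
    Δ-step p q = begin
        Δ (suc (suc (suc (suc n)))) α p q
      ≡⟨ Δ-unfold (suc (suc (suc (suc n)))) α p q ⟩
        det (suc (suc (suc (suc n)))) W
      ≡⟨ sym (det-row₀-minus-row₁ (suc (suc n)) W W₁ (λ j → refl) (λ i j → refl)) ⟩
        det (suc (suc (suc (suc n)))) W₁
      ≡⟨ sym (det-row₁-minus-row₂ (suc n) W₁ W₂ (λ j → refl) (λ j → refl) (λ i j → refl)) ⟩
        det (suc (suc (suc (suc n)))) W₂
      ≡⟨ det-expand-row₀ (suc (suc n)) W₂ (λ j → -‿inverseʳ (W zero (suc (suc j)))) ⟩
        (p ⊖ 𝟘) ⊗ det (suc (suc (suc n))) (minor W₂ zero) ⊖ (𝟘 ⊖ Y) ⊗ det (suc (suc (suc n))) (minor W₂ (suc zero))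
      ≡⟨ cong₂ (λ x y → (p ⊖ 𝟘) ⊗ x ⊖ (𝟘 ⊖ Y) ⊗ y) minor₀ minor₁ ⟩
        (p ⊖ 𝟘) ⊗ ((Y ⊖ ⊝ ι a₂) ⊗ S ⊖ (⊝ ι a₃ ⊖ ε) ⊗ (⊝ ι a₂ ⊗ E))
          ⊖ (𝟘 ⊖ Y) ⊗ ((𝟘 ⊖ q) ⊗ S ⊖ (⊝ ι a₃ ⊖ ε) ⊗ (q ⊗ E))
      ≡⟨ rearrange p q Y (ι a₂) (ι a₃) S E ⟩
        p ⊗ (Y ⊗ S ⊕ ι a₂ ⊗ T) ⊖ q ⊗ (Y ⊗ T)
      ∎
      where
      W W₁ W₂ : Matrix (suc (suc (suc (suc n))))
      W i j = withColumn₀ (suc (suc (suc (suc n)))) α p q (toℕ i) (toℕ j)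
      W₁ zero    j = W zero j ⊖ W (suc zero) j
      W₁ (suc i) j = W (suc i) j
      W₂ (suc zero) j = W (suc zero) j ⊖ W (suc (suc zero)) j
      W₂ i          j = W₁ i j

      E-matrix : Matrix (suc (suc n))
      E-matrix i j = withColumn₀ (suc (suc n)) (shift α) 𝟙 𝟙 (toℕ i) (toℕ j)

      det-E-matrix : det (suc (suc n)) E-matrix ≡ E
      det-E-matrix = sym (Δ-unfold (suc (suc n)) (shift α) 𝟙 𝟙)

      shifted : ∀ r c → charEntry (suc (suc (suc (suc n)))) α (suc (suc r)) (suc (suc (suc c)))
                      ≡ withColumn₀ (suc (suc n)) (shift α) 𝟙 𝟙 r (suc c)
      shifted r c = charEntry-shift (suc (suc n)) α r (suc c)

      S-minor : ∀ {M : Matrix (suc (suc n))} → (∀ r c → M r c ≡ W (suc (suc r)) (suc (suc c))) → det (suc (suc n)) M ≡ S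
      S-minor {M} entries = trans (det-cong (suc (suc n)) λ r c → trans (entries r c) (fit (toℕ r) (toℕ c)))
        (sym (Δ-unfold (suc (suc n)) (shift α) ε (⊝ ι a₃)))
        where
        fit : ∀ r c → charEntry (suc (suc (suc (suc n)))) α (suc (suc r)) (suc (suc c))
                    ≡ withColumn₀ (suc (suc n)) (shift α) ε (⊝ ι a₃) r c
        fit r zero    = trans (charEntry-shift (suc (suc n)) α r 0) (charEntry-column₀ n (shift α) n-even r)
        fit r (suc c) = shifted r c

      minor₀ : det (suc (suc (suc n))) (minor W₂ zero) ≡ (Y ⊖ ⊝ ι a₂) ⊗ S ⊖ (⊝ ι a₃ ⊖ ε) ⊗ (⊝ ι a₂ ⊗ E)
      minor₀ = trans (det-expand-row₀ (suc n) (minor W₂ zero) (λ j → -‿inverseʳ (W (suc zero) (suc (suc (suc j))))))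
        (cong₂ (λ x y → (Y ⊖ ⊝ ι a₂) ⊗ x ⊖ (⊝ ι a₃ ⊖ ε) ⊗ y)
          (S-minor (λ r c → refl))
          (trans (det-scale-column₀ (suc n) (⊝ ι a₂) E-matrix (minor (minor W₂ zero) (suc zero))
                   (λ r → charEntry-column₁ n α n-even (toℕ r)) (λ r c → shifted (toℕ r) (toℕ c)))
                 (cong (⊝ ι a₂ ⊗_) det-E-matrix)))

      minor₁ : det (suc (suc (suc n))) (minor W₂ (suc zero)) ≡ (𝟘 ⊖ q) ⊗ S ⊖ (⊝ ι a₃ ⊖ ε) ⊗ (q ⊗ E)
      minor₁ = trans (det-expand-row₀ (suc n) (minor W₂ (suc zero)) (λ j → -‿inverseʳ (W (suc zero) (suc (suc (suc j))))))
        (cong₂ (λ x y → (𝟘 ⊖ q) ⊗ x ⊖ (⊝ ι a₃ ⊖ ε) ⊗ y)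
          (S-minor (λ r c → refl))
          (trans (det-scale-column₀ (suc n) q E-matrix (minor (minor W₂ (suc zero)) (suc zero))
                   (λ r → column₀-shift p q (toℕ r)) (λ r c → shifted (toℕ r) (toℕ c)))
                 (cong (q ⊗_) det-E-matrix)))

    χ-step : χ (suc (suc (suc (suc n)))) α ≡ ε ⊗ (Y ⊗ S ⊕ ι a₂ ⊗ T) ⊕ ι a₁ ⊗ (Y ⊗ T)
    χ-step = trans (Δ-step ε (⊝ ι a₁)) (lemma ε (Y ⊗ S ⊕ ι a₂ ⊗ T) (ι a₁) (Y ⊗ T))
      where
      lemma : ∀ p x a y → p ⊗ x ⊖ ⊝ a ⊗ y ≡ p ⊗ x ⊕ a ⊗ y
      lemma = Tactic.RingSolver.solve-∀ Dual-ring

    η-step : η (suc (suc (suc (suc n)))) α ≡ Y ⊗ S ⊕ (ι a₂ ⊖ Y) ⊗ T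
    η-step = trans (Δ-step 𝟙 𝟙) (lemma Y S (ι a₂) T)
      where
      lemma : ∀ y s a t → 𝟙 ⊗ (y ⊗ s ⊕ a ⊗ t) ⊖ 𝟙 ⊗ (y ⊗ t) ≡ y ⊗ s ⊕ (a ⊖ y) ⊗ t
      lemma = Tactic.RingSolver.solve-∀ Dual-ring

    τ′ : ℤ
    τ′ = τ (suc (suc n)) (shift α)

    coeff₀-T : coeff₀ T ≡ τ′
    coeff₀-T = cong (λ a → coeff₀ S - a * coeff₀ E) (ℤP.+-identityʳ a₃)

    coeff₀-χ : coeff₀ (χ (suc (suc (suc (suc n)))) α) ≡ - (a₁ * z * τ′)
    coeff₀-χ = begin
        coeff₀ (χ (suc (suc (suc (suc n)))) α)
      ≡⟨ cong coeff₀ χ-step ⟩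
        + 0 * coeff₀ (Y ⊗ S ⊕ ι a₂ ⊗ T) + a₁ * (- z * coeff₀ T)
      ≡⟨ cong (λ t → + 0 * coeff₀ (Y ⊗ S ⊕ ι a₂ ⊗ T) + a₁ * (- z * t)) coeff₀-T ⟩
        + 0 * coeff₀ (Y ⊗ S ⊕ ι a₂ ⊗ T) + a₁ * (- z * τ′)
      ≡⟨ lemma (coeff₀ (Y ⊗ S ⊕ ι a₂ ⊗ T)) a₁ z τ′ ⟩
        - (a₁ * z * τ′)
      ∎
      where
      lemma : ∀ w a z t → + 0 * w + a * (- z * t) ≡ - (a * z * t)
      lemma = solve-∀

    coeff₀-η : coeff₀ (η (suc (suc (suc (suc n)))) α) ≡ a₂ * τ′ - z * a₃ * coeff₀ E
    coeff₀-η = begin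
        coeff₀ (η (suc (suc (suc (suc n)))) α)
      ≡⟨ cong coeff₀ η-step ⟩
        - z * coeff₀ S + (a₂ - - z) * coeff₀ T
      ≡⟨ cong (λ t → - z * coeff₀ S + (a₂ - - z) * t) coeff₀-T ⟩
        - z * coeff₀ S + (a₂ - - z) * (coeff₀ S - a₃ * coeff₀ E)
      ≡⟨ lemma a₂ a₃ z (coeff₀ S) (coeff₀ E) ⟩
        a₂ * τ′ - z * a₃ * coeff₀ E
      ∎
      where
      lemma : ∀ a₂ a₃ z s e → - z * s + (a₂ - - z) * (s - a₃ * e) ≡ a₂ * (s - a₃ * e) - z * a₃ * e
      lemma = solve-∀

    invariant-step : 1 ≤ α 1 → 1 ≤ α 2 → Invariant (suc (suc n)) (shift α) → Invariant (suc (suc (suc (suc n)))) α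
    invariant-step 1≤α₁ 1≤α₂ inv = record
      { s         = - s
      ; s≡±1      = flip s≡±1
      ; ∣x∣       = 2 ℕ.* α 1 ℕ.* x-factor
      ; ∣y∣       = y-factor
      ; 1≤∣x∣     = ℕP.*-mono-≤ (1≤twice 1≤α₁)
                      (ℕP.m≤n⇒m≤n+o _ (ℕP.*-mono-≤ (ℕP.m≤n⇒m≤n+o _ (1≤twice 1≤α₂)) 1≤∣x∣))
      ; 1≤∣y∣     = ℕP.m≤n⇒m≤n+o _ (ℕP.*-mono-≤ (1≤twice 1≤α₂) 1≤∣x∣)
      ; x≡s*∣x∣   = begin
          τ (suc (suc (suc (suc n)))) α
        ≡⟨ cong₂ (λ c e → c - a₁ * e) coeff₀-χ coeff₀-η ⟩
          - (a₁ * z * τ′) - a₁ * (a₂ * τ′ - z * a₃ * coeff₀ E)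
        ≡⟨ cong₂ (λ t e → - (a₁ * z * t) - a₁ * (a₂ * t - z * a₃ * e)) x≡s*∣x∣ y≡-s*∣y∣ ⟩
          - (a₁ * z * (s * + ∣x∣)) - a₁ * (a₂ * (s * + ∣x∣) - z * a₃ * - (s * + ∣y∣))
        ≡⟨ x-lemma a₁ a₂ a₃ z s (+ ∣x∣) (+ ∣y∣) ⟩
          - s * (a₁ * ((a₂ + z) * + ∣x∣ + a₃ * z * + ∣y∣))
        ≡⟨ cong (λ m → - s * (a₁ * m))
             (pos-sum-of-products (2 ℕ.* α 2 ℕ.+ 2 ℕ.* (α 2 ∸ 1)) ∣x∣ (2 ℕ.* α 3) (2 ℕ.* (α 2 ∸ 1)) ∣y∣) ⟩
          - s * (a₁ * + x-factor)
        ≡⟨ cong (- s *_) (pos-* (2 ℕ.* α 1) x-factor) ⟩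
          - s * + (2 ℕ.* α 1 ℕ.* x-factor)
        ∎
      ; y≡-s*∣y∣  = begin
          coeff₀ (η (suc (suc (suc (suc n)))) α)
        ≡⟨ coeff₀-η ⟩
          a₂ * τ′ - z * a₃ * coeff₀ E
        ≡⟨ cong₂ (λ t e → a₂ * t - z * a₃ * e) x≡s*∣x∣ y≡-s*∣y∣ ⟩
          a₂ * (s * + ∣x∣) - z * a₃ * - (s * + ∣y∣)
        ≡⟨ y-lemma a₂ a₃ z s (+ ∣x∣) (+ ∣y∣) ⟩
          - (- s * (a₂ * + ∣x∣ + a₃ * z * + ∣y∣))
        ≡⟨ cong (λ m → - (- s * m))
             (pos-sum-of-products (2 ℕ.* α 2) ∣x∣ (2 ℕ.* α 3) (2 ℕ.* (α 2 ∸ 1)) ∣y∣) ⟩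
          - (- s * + y-factor)
        ∎
      }
      where
      open OppositeSigns inv
      flip : ∀ {s} → s ≡ + 1 ⊎ s ≡ - + 1 → - s ≡ + 1 ⊎ - s ≡ - + 1
      flip (inj₁ refl) = inj₂ refl
      flip (inj₂ refl) = inj₁ refl
      x-factor y-factor : ℕ
      x-factor = (2 ℕ.* α 2 ℕ.+ 2 ℕ.* (α 2 ∸ 1)) ℕ.* ∣x∣ ℕ.+ 2 ℕ.* α 3 ℕ.* (2 ℕ.* (α 2 ∸ 1)) ℕ.* ∣y∣
      y-factor = 2 ℕ.* α 2 ℕ.* ∣x∣ ℕ.+ 2 ℕ.* α 3 ℕ.* (2 ℕ.* (α 2 ∸ 1)) ℕ.* ∣y∣
      x-lemma : ∀ a₁ a₂ a₃ z s u v →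
        - (a₁ * z * (s * u)) - a₁ * (a₂ * (s * u) - z * a₃ * - (s * v)) ≡ - s * (a₁ * ((a₂ + z) * u + a₃ * z * v))
      x-lemma = solve-∀
      y-lemma : ∀ a₂ a₃ z s u v → a₂ * (s * u) - z * a₃ * - (s * v) ≡ - (- s * (a₂ * u + a₃ * z * v))
      y-lemma = solve-∀

    coeff₁-χ : α 2 ≡ 1 → coeff₁ (χ (suc (suc (suc (suc n)))) α) ≡ (a₁ + a₂) * τ′
    coeff₁-χ α₂≡1 = begin
        coeff₁ (χ (suc (suc (suc (suc n)))) α)
      ≡⟨ cong coeff₁ (trans χ-step (cong (λ y → ε ⊗ (y ⊗ S ⊕ ι a₂ ⊗ T) ⊕ ι a₁ ⊗ (y ⊗ T)) Y≡ε)) ⟩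
        coeff₁ (ε ⊗ (ε ⊗ S ⊕ ι a₂ ⊗ T) ⊕ ι a₁ ⊗ (ε ⊗ T))
      ≡⟨ cong coeff₁ (ε²≡0 S (ι a₂) (ι a₁) T) ⟩
        coeff₁ (ε ⊗ ((ι a₁ ⊕ ι a₂) ⊗ T))
      ≡⟨ coeff₁-ε⊗ ((ι a₁ ⊕ ι a₂) ⊗ T) ⟩
        (a₁ + a₂) * coeff₀ T
      ≡⟨ cong ((a₁ + a₂) *_) coeff₀-T ⟩
        (a₁ + a₂) * τ′
      ∎
      where
      Y≡ε : Y ≡ ε
      Y≡ε = cong (λ a → - twice (a ∸ 1) +ε + 1) α₂≡1
      ε²≡0 : ∀ s a b t → ε ⊗ (ε ⊗ s ⊕ a ⊗ t) ⊕ b ⊗ (ε ⊗ t) ≡ ε ⊗ ((b ⊕ a) ⊗ t)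
      ε²≡0 = Tactic.RingSolver.solve-∀ Dual-ring
      coeff₁-ε⊗ : ∀ x → coeff₁ (ε ⊗ x) ≡ coeff₀ x
      coeff₁-ε⊗ x = lemma (coeff₀ x) (coeff₁ x)
        where
        lemma : ∀ a b → + 0 * b + + 1 * a ≡ a
        lemma = solve-∀

    coeff₀-χ≡0⇔ : 1 ≤ α 1 → 1 ≤ α 2 → τ′ ≢ + 0 →
                  (coeff₀ (χ (suc (suc (suc (suc n)))) α) ≡ + 0 ⇔ α 2 ≡ 1)
    coeff₀-χ≡0⇔ 1≤α₁ 1≤α₂ τ′≢0 = mk⇔ to from
      where
      to : coeff₀ (χ (suc (suc (suc (suc n)))) α) ≡ + 0 → α 2 ≡ 1
      to χ₀≡0 = [ a₁z≡0⇒α₂≡1 , (λ τ′≡0 → ⊥-elim (τ′≢0 τ′≡0)) ]′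
        (ℤP.i*j≡0⇒i≡0∨j≡0 (a₁ * z) (ℤP.neg-injective {a₁ * z * τ′} {+ 0} (trans (sym coeff₀-χ) χ₀≡0)))
        where
        a₁z≡0⇒α₂≡1 : a₁ * z ≡ + 0 → α 2 ≡ 1
        a₁z≡0⇒α₂≡1 a₁z≡0 =
          [ (λ a₁≡0 → ⊥-elim (twice≢0 1≤α₁ a₁≡0))
          , (λ z≡0 → ℕP.≤-antisym (ℕP.m∸n≡0⇒m≤n (twice≡0⇒≡0 (α 2 ∸ 1) z≡0)) 1≤α₂)
          ]′ (ℤP.i*j≡0⇒i≡0∨j≡0 a₁ a₁z≡0)
      from : α 2 ≡ 1 → coeff₀ (χ (suc (suc (suc (suc n)))) α) ≡ + 0
      from α₂≡1 = begin
          coeff₀ (χ (suc (suc (suc (suc n)))) α)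
        ≡⟨ coeff₀-χ ⟩
          - (a₁ * twice (α 2 ∸ 1) * τ′)
        ≡⟨ cong (λ a → - (a₁ * twice (a ∸ 1) * τ′)) α₂≡1 ⟩
          - (a₁ * + 0 * τ′)
        ≡⟨ cong (λ x → - (x * τ′)) (ℤP.*-zeroʳ a₁) ⟩
          + 0
        ∎

    coeff₁-χ≢0 : 1 ≤ α 1 → τ′ ≢ + 0 → α 2 ≡ 1 → coeff₁ (χ (suc (suc (suc (suc n)))) α) ≢ + 0
    coeff₁-χ≢0 1≤α₁ τ′≢0 α₂≡1 χ₁≡0 = [ twice-+≢0 (α 2) 1≤α₁ , τ′≢0 ]′
      (ℤP.i*j≡0⇒i≡0∨j≡0 (a₁ + a₂) (trans (sym (coeff₁-χ α₂≡1)) χ₁≡0))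

  Δ₂ : ∀ β p q → Δ 2 β p q ≡ p ⊗ charEntry 2 β 1 1 ⊖ 𝟘 ⊗ 𝟘
  Δ₂ β p q = begin
      Δ 2 β p q
    ≡⟨ Δ-unfold 2 β p q ⟩
      det 2 M
    ≡⟨ det-expand-row₀ 0 M (λ ()) ⟩
      p ⊗ det 1 (minor M zero) ⊖ 𝟘 ⊗ det 1 (minor M (suc zero))
    ≡⟨ cong₂ (λ x y → p ⊗ x ⊖ 𝟘 ⊗ y) (det₁ (minor M zero)) (det₁ (minor M (suc zero))) ⟩
      p ⊗ charEntry 2 β 1 1 ⊖ 𝟘 ⊗ 𝟘
    ∎
    where
    M : Matrix 2
    M i j = withColumn₀ 2 β p q (toℕ i) (toℕ j)

  invariant-base : ∀ β → 1 ≤ β 1 → 2 ≤ β 2 → Invariant 2 β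
  invariant-base β 1≤β₁ 2≤β₂ = record
    { s        = + 1
    ; s≡±1     = inj₁ refl
    ; ∣x∣      = 2 ℕ.* β 1 ℕ.* (2 ℕ.* (β 2 ∸ 1))
    ; ∣y∣      = 2 ℕ.* (β 2 ∸ 1)
    ; 1≤∣x∣    = ℕP.*-mono-≤ (1≤twice 1≤β₁) 1≤z
    ; 1≤∣y∣    = 1≤z
    ; x≡s*∣x∣  = begin
        τ 2 β
      ≡⟨ cong₂ (λ c e → coeff₀ c - twice (β 1) * coeff₀ e) (Δ₂ β ε (⊝ ι (twice (β 1)))) (Δ₂ β 𝟙 𝟙) ⟩
        (+ 0 * - z + - (+ 0 * + 0)) - twice (β 1) * (+ 1 * - z + - (+ 0 * + 0))
      ≡⟨ x-lemma (twice (β 1)) z ⟩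
        + 1 * (twice (β 1) * z)
      ≡⟨ cong (+ 1 *_) (pos-* (2 ℕ.* β 1) (2 ℕ.* (β 2 ∸ 1))) ⟩
        + 1 * + (2 ℕ.* β 1 ℕ.* (2 ℕ.* (β 2 ∸ 1)))
      ∎
    ; y≡-s*∣y∣ = trans (cong coeff₀ (Δ₂ β 𝟙 𝟙)) (y-lemma z)
    }
    where
    z : ℤ
    z = twice (β 2 ∸ 1)
    1≤z : 1 ≤ 2 ℕ.* (β 2 ∸ 1)
    1≤z = 1≤twice (ℕP.∸-monoˡ-≤ 1 2≤β₂)
    x-lemma : ∀ b z → (+ 0 * - z + - (+ 0 * + 0)) - b * (+ 1 * - z + - (+ 0 * + 0)) ≡ + 1 * (b * z)
    x-lemma = solve-∀
    y-lemma : ∀ z → + 1 * - z + - (+ 0 * + 0) ≡ - (+ 1 * z)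
    y-lemma = solve-∀

  PositiveUpTo : ℕ → (ℕ → ℕ) → Set
  PositiveUpTo N β = ∀ i → 1 ≤ i → i ≤ N → 1 ≤ β i

  oddᵇ-*2 : ∀ m → oddᵇ (m ℕ.* 2) ≡ false
  oddᵇ-*2 zero    = refl
  oddᵇ-*2 (suc m) rewrite oddᵇ-*2 m = refl

  invariant : ∀ m β → PositiveUpTo (suc m ℕ.* 2) β → 2 ≤ β (suc m ℕ.* 2) → Invariant (suc m ℕ.* 2) β
  invariant zero    β positive last = invariant-base β (positive 1 ℕP.≤-refl (s≤s z≤n)) last
  invariant (suc m) β positive last = Step.invariant-step (m ℕ.* 2) β (oddᵇ-*2 m)
    (positive 1 ℕP.≤-refl (s≤s z≤n)) (positive 2 (s≤s z≤n) (s≤s (s≤s z≤n)))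
    (invariant m (shift β) (λ i _ i≤ → positive (suc (suc i)) (s≤s z≤n) (s≤s (s≤s i≤))) last)

  jet-charPoly-Q : ∀ m α → let k = suc (suc m) in jet (charPoly (2 ℕ.* k) (Qℤ k α)) ≡ χ (k ℕ.* 2) α
  jet-charPoly-Q m α = begin
      jet (charPoly (2 ℕ.* k) (Qℤ k α))
    ≡⟨ jet-charPoly (2 ℕ.* k) (Qℤ k α) ⟩
      det (2 ℕ.* k) (λ i j → - Qℤ k α i j +ε (if toℕ i ≡ᵇ toℕ j then + 1 else + 0))
    ≡⟨ det-cong (2 ℕ.* k) {N = charMatrix (2 ℕ.* k)} (λ i j → refl) ⟩
      det (2 ℕ.* k) (charMatrix (2 ℕ.* k))
    ≡⟨ cong (λ N → det N (charMatrix N)) (ℕP.*-comm 2 k) ⟩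
      det (k ℕ.* 2) (charMatrix (k ℕ.* 2))
    ≡⟨ det-cong (k ℕ.* 2) {charMatrix (k ℕ.* 2)} {χ-matrix} (λ i j → column₀-fit (toℕ i) (toℕ j)) ⟩
      det (k ℕ.* 2) χ-matrix
    ≡⟨ sym (Δ-unfold (k ℕ.* 2) α ε (⊝ ι (twice (α 1)))) ⟩
      χ (k ℕ.* 2) α
    ∎
    where
    k : ℕ
    k = suc (suc m)
    charMatrix : (N : ℕ) → Matrix N
    charMatrix N i j = charEntry N α (toℕ i) (toℕ j)
    χ-matrix : Matrix (k ℕ.* 2)
    χ-matrix i j = withColumn₀ (k ℕ.* 2) α ε (⊝ ι (twice (α 1))) (toℕ i) (toℕ j)
    column₀-fit : ∀ i j → charEntry (k ℕ.* 2) α i j ≡ withColumn₀ (k ℕ.* 2) α ε (⊝ ι (twice (α 1))) i j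
    column₀-fit i zero    = charEntry-column₀ (suc m ℕ.* 2) α (oddᵇ-*2 (suc m)) i
    column₀-fit i (suc j) = refl

open import Data.Integer using (+_)
open import Data.Nat using (_≤_; _*_; s≤s; z≤n)
import Data.Nat.Properties as ℕP
open import Data.Product using (_,_; _×_; proj₁)
open import Function.Bundles using (_⇔_; mk⇔; Equivalence)
open import Defs using (SimpleEigenvalue; Qℤ; charPoly; coeff)
open DualNumbers using (coeff₀; coeff₁)
open Truncation using (simpleEigenvalue0⇔)
open QuotientMatrix

mainTheorem3 : (k : ℕ) → 2 ≤ k → (α : ℕ → ℕ) →
    (∀ i → 1 ≤ i → i ≤ 2 * k → 1 ≤ α i) → 2 ≤ α (2 * k) →
    (SimpleEigenvalue (2 * k) (Qℤ k α) (+ 0) ⇔ α 2 ≡ 1)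
mainTheorem3 (suc (suc m)) (s≤s (s≤s z≤n)) α positive last = mk⇔
  (λ simple → Equivalence.to constant-term≡0⇔ (proj₁ (Equivalence.to criterion simple)))
  (λ α₂≡1 → Equivalence.from criterion
    ( Equivalence.from constant-term≡0⇔ α₂≡1
    , subst (λ c → coeff₁ c ≢ + 0) (sym (jet-charPoly-Q m α)) (coeff₁-χ≢0 1≤α₁ τ′≢0 α₂≡1)))
  where
  open Step (m * 2) α (oddᵇ-*2 m)
  k : ℕ
  k = suc (suc m)
  criterion : SimpleEigenvalue (2 * k) (Qℤ k α) (+ 0)
              ⇔ (coeff (charPoly (2 * k) (Qℤ k α)) 0 ≡ + 0 × coeff (charPoly (2 * k) (Qℤ k α)) 1 ≢ + 0)
  criterion = simpleEigenvalue0⇔ (2 * k) (Qℤ k α)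
  1≤α₁ : 1 ≤ α 1
  1≤α₁ = positive 1 ℕP.≤-refl (s≤s z≤n)
  τ′≢0 : τ′ ≢ + 0
  τ′≢0 = OppositeSigns.x≢0 (invariant m (shift α)
    (λ i _ i≤ → positive (suc (suc i)) (s≤s z≤n) (subst (suc (suc i) ≤_) (ℕP.*-comm k 2) (s≤s (s≤s i≤))))
    (subst (λ N → 2 ≤ α N) (ℕP.*-comm 2 k) last))
  constant-term≡0⇔ : coeff (charPoly (2 * k) (Qℤ k α)) 0 ≡ + 0 ⇔ α 2 ≡ 1
  constant-term≡0⇔ = subst (λ c → (coeff₀ c ≡ + 0) ⇔ α 2 ≡ 1) (sym (jet-charPoly-Q m α))
    (coeff₀-χ≡0⇔ 1≤α₁ (positive 2 (s≤s z≤n) (s≤s (s≤s z≤n))) τ′≢0)
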